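{- Let $k,m>1$ be integers and $i\in\{0,1,\ldots,m-1\}$. Then $r_\mathcal{M}(i,m,k)=r_\mathcal{M}(\gcd(i,m),m,k)$.
   Context: $\mathbb{N}=\{0,1,2,\ldots\}$; $\gcd(0,m)=m$. Let $\mathcal{M}=(m^{j-1})_{j\in\mathbb{N}_+}$ and let $p_\mathcal{M}(n,k)$ be the number of tuples $(x_1,\ldots,x_k)\in\mathbb{N}^k$ with $x_1+mx_2+\cdots+m^{k-1}x_k=n$. For integers $k\ge1$ and any integer $i$, define $r_\mathcal{M}(i,m,k)=\#\{n\in\{0,1,\ldots,m^k-1\}:\ p_\mathcal{M}(n,k)\equiv i\pmod{m}\}$. -}

module Defs where

open import Data.Nat using (ℕ; zero; suc; _+_; _*_; _^_)
open import Data.Nat.Properties using (_≟_)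
open import Data.Nat.DivMod using (_%_)
open import Data.Fin using (Fin; toℕ)
open import Data.List using (List; []; _∷_; map; concatMap; upTo; length; filter)
open import Data.Vec using (Vec; []; _∷_)
open import Relation.Nullary.Decidable using (does)
open import Data.Bool using (Bool)

tuples : (b k : ℕ) → List (Vec ℕ k)
tuples b zero    = [] ∷ []
tuples b (suc k) = concatMap (λ x → map (x ∷_) (tuples b k)) (upTo (suc b))

wsum : (m : ℕ) → ∀ {k} → Vec ℕ k → ℕ
wsum m []       = 0
wsum m (x ∷ xs) = x + m * wsum m xs

-- p_M(n,k) = #{(x₁,…,x_k) ∈ ℕ^k : x₁ + m x₂ + ⋯ + m^{k-1} x_k = n}  (for m ≥ 1).
-- Any such tuple has every xⱼ ≤ n (since m^{j-1} ≥ 1), so enumerating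
-- tuples with entries ≤ n counts all of them.
pM : (m n k : ℕ) → ℕ
pM m n k = length (filter (λ v → wsum m v ≟ n) (tuples n k))

rM : (i m k : ℕ) .{{_ : Data.Nat.NonZero m}} → ℕ
rM i m k = length (filter (λ n → (pM m n k % m) ≟ (i % m)) (upTo (m ^ k)))

-- Sorting the tuples by the value of x₂ + m x₃ + ⋯ gives the recursion
-- p(n, k+1) = Σ_{s ≤ ⌊n/m⌋} p(s, k). Applied twice it shows that, for
-- n = (a m + b) m + c with b, c < m, p(n, k+2) ≡ (b+1)·P(a) (mod m), where
-- P(a) = Σ_{s ≤ a} p(s, k). Hence r(i) counts, for each a < m^k, m times the
-- number of x ∈ ℤ/m with x·P(a) ≡ i. That number is 0 when gcd(P(a), m) ∤ i
-- and otherwise equals the number of solutions of x·P(a) ≡ 0 (translate by a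
-- Bézout solution), so it is the same for i and for gcd(i, m).
module Submission where

open import Defs
open import Data.Nat
  using (ℕ; zero; suc; _+_; _*_; _^_; _∸_; pred; _≤_; _<_; z≤n; s≤s; s≤s⁻¹; NonZero; _≤?_; _<?_)
open import Data.Nat.Properties
open import Data.Nat.DivMod
open import Data.Nat.Divisibility
open import Data.Nat.GCD
open import Data.List using (List; []; _∷_; _++_; map; concatMap; applyUpTo; upTo; filter; length)
open import Data.Vec using (_∷_)
open import Data.Product using (∃-syntax; _,_)
open import Data.Bool using (true; false; if_then_else_)
open import Function using (_∘_; _⇔_; mk⇔)
open import Relation.Nullary using (Dec; does; ¬_; yes; no)
open import Relation.Nullary.Decidable using (dec-true; dec-false; does-⇔)
open import Relation.Binary.PropositionalEquality
open ≡-Reasoning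
open import Algebra.Properties.CommutativeSemigroup +-commutativeSemigroup
  using () renaming (interchange to +-interchange)

private
  variable
    A B X Y : Set

𝟙 : Dec X → ℕ
𝟙 p = if does p then 1 else 0

𝟙-yes : X → (p : Dec X) → 𝟙 p ≡ 1
𝟙-yes x p rewrite dec-true p x = refl

𝟙-no : ¬ X → (p : Dec X) → 𝟙 p ≡ 0
𝟙-no ¬x p rewrite dec-false p ¬x = refl

𝟙-⇔ : X ⇔ Y → (p : Dec X) (q : Dec Y) → 𝟙 p ≡ 𝟙 q
𝟙-⇔ X⇔Y p q = cong (λ b → if b then 1 else 0) (does-⇔ X⇔Y p q)

∑< : ℕ → (ℕ → ℕ) → ℕ
∑< zero    f = 0
∑< (suc n) f = f 0 + ∑< n (f ∘ suc)

infixl 10 ∑<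
syntax ∑< n (λ x → e) = ∑[ x < n ] e

∑-cong : ∀ n {f g : ℕ → ℕ} → (∀ x → x < n → f x ≡ g x) → ∑[ x < n ] f x ≡ ∑[ x < n ] g x
∑-cong zero    f≗g = refl
∑-cong (suc n) f≗g = cong₂ _+_ (f≗g 0 (s≤s z≤n)) (∑-cong n (λ x x<n → f≗g (suc x) (s≤s x<n)))

∑-0 : ∀ n → ∑[ x < n ] 0 ≡ 0
∑-0 zero    = refl
∑-0 (suc n) = ∑-0 n

∑-const : ∀ n c → ∑[ x < n ] c ≡ n * c
∑-const zero    c = refl
∑-const (suc n) c = cong (c +_) (∑-const n c)

∑-*ˡ : ∀ n c (f : ℕ → ℕ) → ∑[ x < n ] (c * f x) ≡ c * ∑[ x < n ] f x
∑-*ˡ zero    c f = sym (*-zeroʳ c)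
∑-*ˡ (suc n) c f = trans (cong (c * f 0 +_) (∑-*ˡ n c (f ∘ suc))) (sym (*-distribˡ-+ c (f 0) _))

∑-distrib-+ : ∀ n (f g : ℕ → ℕ) → ∑[ x < n ] (f x + g x) ≡ ∑[ x < n ] f x + ∑[ x < n ] g x
∑-distrib-+ zero    f g = refl
∑-distrib-+ (suc n) f g =
  trans (cong (f 0 + g 0 +_) (∑-distrib-+ n (f ∘ suc) (g ∘ suc))) (+-interchange (f 0) (g 0) _ _)

∑-+ : ∀ a b (f : ℕ → ℕ) → ∑[ x < a + b ] f x ≡ ∑[ x < a ] f x + ∑[ y < b ] f (a + y)
∑-+ zero    b f = refl
∑-+ (suc a) b f = trans (cong (f 0 +_) (∑-+ a b (f ∘ suc))) (sym (+-assoc (f 0) _ _))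

∑-blocks : ∀ a n (f : ℕ → ℕ) → ∑[ x < a * n ] f x ≡ ∑[ q < a ] ∑[ r < n ] f (q * n + r)
∑-blocks zero    n f = refl
∑-blocks (suc a) n f = begin
  ∑[ x < n + a * n ] f x
    ≡⟨ ∑-+ n (a * n) f ⟩
  ∑[ r < n ] f r + ∑[ y < a * n ] f (n + y)
    ≡⟨ cong (∑[ r < n ] f r +_) (∑-blocks a n (λ y → f (n + y))) ⟩
  ∑[ r < n ] f r + ∑[ q < a ] ∑[ r < n ] f (n + (q * n + r))
    ≡⟨ cong (∑[ r < n ] f r +_) (∑-cong a (λ q _ → ∑-cong n (λ r _ → cong f (+-assoc n (q * n) r)))) ⟨
  ∑[ r < n ] f r + ∑[ q < a ] ∑[ r < n ] f (suc q * n + r) ∎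

∑-shift : ∀ n (f : ℕ → ℕ) → ∑[ x < n ] f (suc x) + f 0 ≡ ∑[ x < n ] f x + f n
∑-shift zero    f = refl
∑-shift (suc n) f = begin
  f 1 + ∑[ x < n ] f (2 + x) + f 0         ≡⟨ cong (_+ f 0) (+-comm (f 1) _) ⟩
  ∑[ x < n ] f (2 + x) + f 1 + f 0         ≡⟨ cong (_+ f 0) (∑-shift n (f ∘ suc)) ⟩
  ∑[ x < n ] f (suc x) + f (suc n) + f 0   ≡⟨ +-comm _ (f 0) ⟩
  f 0 + (∑[ x < n ] f (suc x) + f (suc n)) ≡⟨ +-assoc (f 0) _ _ ⟨
  f 0 + ∑[ x < n ] f (suc x) + f (suc n)   ∎

∑-rotate : ∀ n (f : ℕ → ℕ) → (∀ x → f (n + x) ≡ f x) → ∀ t → ∑[ x < n ] f (t + x) ≡ ∑[ x < n ] f x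
∑-rotate n f periodic zero    = refl
∑-rotate n f periodic (suc t) = begin
  ∑[ x < n ] f (suc t + x)  ≡⟨ ∑-cong n (λ x _ → cong f (sym (+-suc t x))) ⟩
  ∑[ x < n ] f (t + suc x)  ≡⟨ +-cancelʳ-≡ (f (t + 0)) _ _ shifted ⟩
  ∑[ x < n ] f (t + x)      ≡⟨ ∑-rotate n f periodic t ⟩
  ∑[ x < n ] f x            ∎
  where
  wraps : f (t + n) ≡ f (t + 0)
  wraps = trans (cong f (+-comm t n)) (trans (periodic t) (cong f (sym (+-identityʳ t))))
  shifted : ∑[ x < n ] f (t + suc x) + f (t + 0) ≡ ∑[ x < n ] f (t + x) + f (t + 0)
  shifted = trans (∑-shift n (λ x → f (t + x))) (cong (∑[ x < n ] f (t + x) +_) wraps)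

∑∈ : List A → (A → ℕ) → ℕ
∑∈ []       f = 0
∑∈ (x ∷ xs) f = f x + ∑∈ xs f

infixl 10 ∑∈
syntax ∑∈ xs (λ x → e) = ∑[ x ∈ xs ] e

length-filter : {R : A → Set} (R? : ∀ x → Dec (R x)) (xs : List A) →
                length (filter R? xs) ≡ ∑[ x ∈ xs ] 𝟙 (R? x)
length-filter R? []       = refl
length-filter R? (x ∷ xs) with does (R? x)
... | true  = cong suc (length-filter R? xs)
... | false = length-filter R? xs

∑∈-++ : (xs ys : List A) (f : A → ℕ) → ∑[ x ∈ xs ++ ys ] f x ≡ ∑[ x ∈ xs ] f x + ∑[ y ∈ ys ] f y
∑∈-++ []       ys f = refl
∑∈-++ (x ∷ xs) ys f = trans (cong (f x +_) (∑∈-++ xs ys f)) (sym (+-assoc (f x) _ _))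

∑∈-map : (h : A → B) (xs : List A) (f : B → ℕ) → ∑[ y ∈ map h xs ] f y ≡ ∑[ x ∈ xs ] f (h x)
∑∈-map h []       f = refl
∑∈-map h (x ∷ xs) f = cong (f (h x) +_) (∑∈-map h xs f)

∑∈-concatMap : (h : A → List B) (xs : List A) (f : B → ℕ) →
               ∑[ y ∈ concatMap h xs ] f y ≡ ∑[ x ∈ xs ] ∑[ y ∈ h x ] f y
∑∈-concatMap h []       f = refl
∑∈-concatMap h (x ∷ xs) f = trans (∑∈-++ (h x) _ f) (cong (∑[ y ∈ h x ] f y +_) (∑∈-concatMap h xs f))

∑∈-applyUpTo : (h : ℕ → ℕ) (n : ℕ) (f : ℕ → ℕ) → ∑[ y ∈ applyUpTo h n ] f y ≡ ∑[ x < n ] f (h x)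
∑∈-applyUpTo h zero    f = refl
∑∈-applyUpTo h (suc n) f = cong (f (h 0) +_) (∑∈-applyUpTo (h ∘ suc) n f)

∑∈-cong : (xs : List A) {f g : A → ℕ} → (∀ x → f x ≡ g x) → ∑[ x ∈ xs ] f x ≡ ∑[ x ∈ xs ] g x
∑∈-cong []       f≗g = refl
∑∈-cong (x ∷ xs) f≗g = cong₂ _+_ (f≗g x) (∑∈-cong xs f≗g)

∑∈-∑-comm : (xs : List A) (n : ℕ) (f : A → ℕ → ℕ) →
            ∑[ x ∈ xs ] ∑[ y < n ] f x y ≡ ∑[ y < n ] ∑[ x ∈ xs ] f x y
∑∈-∑-comm []       n f = sym (∑-0 n)
∑∈-∑-comm (x ∷ xs) n f =
  trans (cong (∑[ y < n ] f x y +_) (∑∈-∑-comm xs n f))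
        (sym (∑-distrib-+ n (f x) (λ y → ∑[ x ∈ xs ] f x y)))

∑-𝟙-≟ : ∀ n w → ∑[ s < n ] 𝟙 (w ≟ s) ≡ 𝟙 (w <? n)
∑-𝟙-≟ zero    w       = refl
∑-𝟙-≟ (suc n) zero    = cong suc (∑-0 n)
∑-𝟙-≟ (suc n) (suc w) = ∑-𝟙-≟ n w

∑-𝟙-+≟ : ∀ n c {t} → t < n → ∑[ x < n ] 𝟙 (x + c ≟ t) ≡ 𝟙 (c ≤? t)
∑-𝟙-+≟ n c {t} t<n with c ≤? t
... | yes c≤t = begin
  ∑[ x < n ] 𝟙 (x + c ≟ t)  ≡⟨ ∑-cong n (λ x _ → 𝟙-⇔ (solve x) (x + c ≟ t) (t ∸ c ≟ x)) ⟩
  ∑[ x < n ] 𝟙 (t ∸ c ≟ x)  ≡⟨ ∑-𝟙-≟ n (t ∸ c) ⟩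
  𝟙 (t ∸ c <? n)            ≡⟨ 𝟙-yes (≤-<-trans (m∸n≤m t c) t<n) (t ∸ c <? n) ⟩
  1                         ≡⟨ 𝟙-yes c≤t (c ≤? t) ⟨
  𝟙 (c ≤? t)                ∎
  where
  solve : ∀ x → x + c ≡ t ⇔ t ∸ c ≡ x
  solve x = mk⇔ (λ eq → trans (cong (_∸ c) (sym eq)) (m+n∸n≡m x c))
                (λ eq → trans (cong (_+ c) (sym eq)) (m∸n+n≡m c≤t))
... | no c≰t = begin
  ∑[ x < n ] 𝟙 (x + c ≟ t)  ≡⟨ ∑-cong n (λ x _ →
                                 𝟙-no (λ eq → c≰t (subst (c ≤_) eq (m≤n+m c x))) (x + c ≟ t)) ⟩
  ∑[ x < n ] 0              ≡⟨ ∑-0 n ⟩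
  0                         ≡⟨ 𝟙-no c≰t (c ≤? t) ⟨
  𝟙 (c ≤? t)                ∎

d*w≤n⇔w<1+n/d : ∀ d {w n} .{{_ : NonZero d}} → d * w ≤ n ⇔ w < suc (n / d)
d*w≤n⇔w<1+n/d d {w} {n} = mk⇔ to from
  where
  to : d * w ≤ n → w < suc (n / d)
  to dw≤n = s≤s (subst (_≤ n / d) (trans (cong (_/ d) (*-comm d w)) (m*n/n≡m w d)) (/-monoˡ-≤ d dw≤n))
  from : w < suc (n / d) → d * w ≤ n
  from w<1+n/d = ≤-trans (*-monoʳ-≤ d (s≤s⁻¹ w<1+n/d)) (subst (_≤ n) (*-comm (n / d) d) (m/n*n≤m n d))

[q*n+r]/n≡q : ∀ q {n r} .{{_ : NonZero n}} → r < n → (q * n + r) / n ≡ q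
[q*n+r]/n≡q q {n} {r} r<n = begin
  (q * n + r) / n    ≡⟨ +-distrib-/-∣ˡ r (n∣m*n q) ⟩
  q * n / n + r / n  ≡⟨ cong₂ _+_ (m*n/n≡m q n) (m<n⇒m/n≡0 r<n) ⟩
  q + 0              ≡⟨ +-identityʳ q ⟩
  q                  ∎

%-+-congˡ : ∀ a {b c d} .{{_ : NonZero d}} → b % d ≡ c % d → (a + b) % d ≡ (a + c) % d
%-+-congˡ a {b} {c} {d} eq = begin
  (a + b) % d          ≡⟨ %-distribˡ-+ a b d ⟩
  (a % d + b % d) % d  ≡⟨ cong (λ r → (a % d + r) % d) eq ⟩
  (a % d + c % d) % d  ≡⟨ %-distribˡ-+ a c d ⟨
  (a + c) % d          ∎

%-*-congˡ : ∀ a {b c d} .{{_ : NonZero d}} → b % d ≡ c % d → (a * b) % d ≡ (a * c) % d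
%-*-congˡ a {b} {c} {d} eq = begin
  (a * b) % d            ≡⟨ %-distribˡ-* a b d ⟩
  (a % d * (b % d)) % d  ≡⟨ cong (λ r → (a % d * r) % d) eq ⟩
  (a % d * (c % d)) % d  ≡⟨ %-distribˡ-* a c d ⟨
  (a * c) % d            ∎

%-+-cancelˡ : ∀ a {b c d} .{{_ : NonZero d}} → (a + b) % d ≡ (a + c) % d → b % d ≡ c % d
%-+-cancelˡ a {b} {c} {d} eq = begin
  b % d                        ≡⟨ add-inverse b ⟩
  (pred d * a + (a + b)) % d   ≡⟨ %-+-congˡ (pred d * a) eq ⟩
  (pred d * a + (a + c)) % d   ≡⟨ add-inverse c ⟨
  c % d                        ∎
  where
  add-inverse : ∀ x → x % d ≡ (pred d * a + (a + x)) % d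
  add-inverse x = begin
    x % d                        ≡⟨ %-remove-+ˡ x (m∣m*n a) ⟨
    (d * a + x) % d              ≡⟨ cong (λ e → (e * a + x) % d) (suc-pred d) ⟨
    (a + pred d * a + x) % d     ≡⟨ cong (λ e → (e + x) % d) (+-comm a (pred d * a)) ⟩
    (pred d * a + a + x) % d     ≡⟨ cong (_% d) (+-assoc (pred d * a) a x) ⟩
    (pred d * a + (a + x)) % d   ∎

module _ (m : ℕ) .{{_ : NonZero m}} where

  p : ℕ → ℕ → ℕ
  p n zero    = 𝟙 (0 ≟ n)
  p n (suc k) = ∑[ s < suc (n / m) ] p s k

  P : ℕ → ℕ → ℕ
  P q k = ∑[ s < suc q ] p s k

  tupleCount : (b k n : ℕ) → ℕ
  tupleCount b k n = ∑[ v ∈ tuples b k ] 𝟙 (wsum m v ≟ n)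

  tupleCount≡p : ∀ k {b n} → n ≤ b → tupleCount b k n ≡ p n k
  tupleCount≡p zero            _   = +-identityʳ _
  tupleCount≡p (suc k) {b} {n} n≤b = begin
    ∑[ v ∈ tuples b (suc k) ] 𝟙 (wsum m v ≟ n)
      ≡⟨ ∑∈-concatMap (λ x → map (x ∷_) (tuples b k)) (upTo (suc b)) _ ⟩
    ∑[ x ∈ upTo (suc b) ] ∑[ v ∈ map (x ∷_) (tuples b k) ] 𝟙 (wsum m v ≟ n)
      ≡⟨ ∑∈-applyUpTo (λ x → x) (suc b) _ ⟩
    ∑[ x < suc b ] ∑[ v ∈ map (x ∷_) (tuples b k) ] 𝟙 (wsum m v ≟ n)
      ≡⟨ ∑-cong (suc b) (λ x _ → ∑∈-map (x ∷_) (tuples b k) (λ v → 𝟙 (wsum m v ≟ n))) ⟩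
    ∑[ x < suc b ] ∑[ v ∈ tuples b k ] 𝟙 (x + m * wsum m v ≟ n)
      ≡⟨ ∑∈-∑-comm (tuples b k) (suc b) (λ v x → 𝟙 (x + m * wsum m v ≟ n)) ⟨
    ∑[ v ∈ tuples b k ] ∑[ x < suc b ] 𝟙 (x + m * wsum m v ≟ n)
      ≡⟨ ∑∈-cong (tuples b k) (λ v → ∑-𝟙-+≟ (suc b) (m * wsum m v) (s≤s n≤b)) ⟩
    ∑[ v ∈ tuples b k ] 𝟙 (m * wsum m v ≤? n)
      ≡⟨ ∑∈-cong (tuples b k) (λ v →
           𝟙-⇔ (d*w≤n⇔w<1+n/d m) (m * wsum m v ≤? n) (wsum m v <? suc (n / m))) ⟩
    ∑[ v ∈ tuples b k ] 𝟙 (wsum m v <? suc (n / m))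
      ≡⟨ ∑∈-cong (tuples b k) (λ v → ∑-𝟙-≟ (suc (n / m)) (wsum m v)) ⟨
    ∑[ v ∈ tuples b k ] ∑[ s < suc (n / m) ] 𝟙 (wsum m v ≟ s)
      ≡⟨ ∑∈-∑-comm (tuples b k) (suc (n / m)) (λ v s → 𝟙 (wsum m v ≟ s)) ⟩
    ∑[ s < suc (n / m) ] tupleCount b k s
      ≡⟨ ∑-cong (suc (n / m)) (λ s s≤n/m →
           tupleCount≡p k (≤-trans (s≤s⁻¹ s≤n/m) (≤-trans (m/n≤m n m) n≤b))) ⟩
    p n (suc k) ∎

  pM≡p : ∀ n k → pM m n k ≡ p n k
  pM≡p n k = trans (length-filter (λ v → wsum m v ≟ n) (tuples n k)) (tupleCount≡p k ≤-refl)

  p≡P : ∀ q {r} k → r < m → p (q * m + r) (suc k) ≡ P q k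
  p≡P q k r<m = cong (λ a → P a k) ([q*n+r]/n≡q q r<m)

  P-suc : ∀ a {b} k → b < m → P (a * m + b) (suc k) ≡ m * ∑[ q < a ] P q k + suc b * P a k
  P-suc a {b} k b<m = begin
    ∑[ s < suc (a * m + b) ] p s (suc k)
      ≡⟨ cong (λ n → ∑[ s < n ] p s (suc k)) (+-suc (a * m) b) ⟨
    ∑[ s < a * m + suc b ] p s (suc k)
      ≡⟨ ∑-+ (a * m) (suc b) (λ s → p s (suc k)) ⟩
    ∑[ s < a * m ] p s (suc k) + ∑[ r < suc b ] p (a * m + r) (suc k)
      ≡⟨ cong₂ _+_ fullBlocks lastBlock ⟩
    m * ∑[ q < a ] P q k + suc b * P a k ∎
    where
    fullBlocks : ∑[ s < a * m ] p s (suc k) ≡ m * ∑[ q < a ] P q k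
    fullBlocks = begin
      ∑[ s < a * m ] p s (suc k)                    ≡⟨ ∑-blocks a m (λ s → p s (suc k)) ⟩
      ∑[ q < a ] ∑[ r < m ] p (q * m + r) (suc k)   ≡⟨ ∑-cong a (λ q _ →
                                                        trans (∑-cong m (λ r → p≡P q k)) (∑-const m (P q k))) ⟩
      ∑[ q < a ] (m * P q k)                        ≡⟨ ∑-*ˡ a m (λ q → P q k) ⟩
      m * ∑[ q < a ] P q k                          ∎
    lastBlock : ∑[ r < suc b ] p (a * m + r) (suc k) ≡ suc b * P a k
    lastBlock = trans (∑-cong (suc b) (λ r r≤b → p≡P a k (≤-<-trans (s≤s⁻¹ r≤b) b<m)))
                      (∑-const (suc b) (P a k))

  p-digits : ∀ k a {b c} → b < m → c < m → p ((a * m + b) * m + c) (2 + k) % m ≡ suc b * P a k % m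
  p-digits k a {b} {c} b<m c<m = begin
    p ((a * m + b) * m + c) (2 + k) % m
      ≡⟨ cong (_% m) (trans (p≡P (a * m + b) (suc k) c<m) (P-suc a k b<m)) ⟩
    (m * ∑[ q < a ] P q k + suc b * P a k) % m
      ≡⟨ %-remove-+ˡ (suc b * P a k) (m∣m*n _) ⟩
    suc b * P a k % m ∎

  solutionCount : ℕ → ℕ → ℕ
  solutionCount y j = ∑[ x < m ] 𝟙 (x * y % m ≟ j % m)

  solution-periodic : ∀ y j x → 𝟙 ((m + x) * y % m ≟ j % m) ≡ 𝟙 (x * y % m ≟ j % m)
  solution-periodic y j x = cong (λ r → 𝟙 (r ≟ j % m))
    (trans (cong (_% m) (*-distribʳ-+ y m x)) (%-remove-+ˡ (x * y) (m∣m*n y)))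

  rM≡∑solutionCount : ∀ k j → rM j m (2 + k) ≡ ∑[ a < m ^ k ] (m * solutionCount (P a k) j)
  rM≡∑solutionCount k j = begin
    rM j m (2 + k)
      ≡⟨ length-filter (λ n → pM m n (2 + k) % m ≟ j % m) (upTo (m ^ (2 + k))) ⟩
    ∑[ n ∈ upTo (m ^ (2 + k)) ] f n
      ≡⟨ ∑∈-applyUpTo (λ n → n) (m ^ (2 + k)) f ⟩
    ∑[ n < m ^ (2 + k) ] f n
      ≡⟨ cong (λ N → ∑[ n < N ] f n) (trans (*-comm m _) (cong (_* m) (*-comm m (m ^ k)))) ⟩
    ∑[ n < m ^ k * m * m ] f n
      ≡⟨ ∑-blocks (m ^ k * m) m f ⟩
    ∑[ q < m ^ k * m ] ∑[ c < m ] f (q * m + c)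
      ≡⟨ ∑-blocks (m ^ k) m (λ q → ∑[ c < m ] f (q * m + c)) ⟩
    ∑[ a < m ^ k ] ∑[ b < m ] ∑[ c < m ] f ((a * m + b) * m + c)
      ≡⟨ ∑-cong (m ^ k) (λ a _ → ∑-cong m (λ b b<m →
           trans (∑-cong m (λ c → f-digits a b<m)) (∑-const m _))) ⟩
    ∑[ a < m ^ k ] ∑[ b < m ] (m * 𝟙 (suc b * P a k % m ≟ j % m))
      ≡⟨ ∑-cong (m ^ k) (λ a _ → ∑-*ˡ m m (λ b → 𝟙 (suc b * P a k % m ≟ j % m))) ⟩
    ∑[ a < m ^ k ] (m * ∑[ b < m ] 𝟙 (suc b * P a k % m ≟ j % m))
      ≡⟨ ∑-cong (m ^ k) (λ a _ → cong (m *_) (∑-rotate m _ (solution-periodic (P a k) j) 1)) ⟩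
    ∑[ a < m ^ k ] (m * solutionCount (P a k) j) ∎
    where
    f : ℕ → ℕ
    f n = 𝟙 (pM m n (2 + k) % m ≟ j % m)
    f-digits : ∀ a {b c} → b < m → c < m → f ((a * m + b) * m + c) ≡ 𝟙 (suc b * P a k % m ≟ j % m)
    f-digits a b<m c<m = cong (λ r → 𝟙 (r ≟ j % m)) (trans (cong (_% m) (pM≡p _ (2 + k))) (p-digits k a b<m c<m))

  solutionCount-unsolvable : ∀ {y j} → ¬ (gcd y m ∣ j) → solutionCount y j ≡ 0
  solutionCount-unsolvable {y} {j} g∤j =
    trans (∑-cong m (λ x _ → 𝟙-no (g∤j ∘ gcd∣j x) (x * y % m ≟ j % m))) (∑-0 m)
    where
    gcd∣j : ∀ x → x * y % m ≡ j % m → gcd y m ∣ j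
    gcd∣j x eq = ∣n∣m%n⇒∣m (gcd[m,n]∣n y m)
      (subst (gcd y m ∣_) eq (%-presˡ-∣ (∣n⇒∣m*n x (gcd[m,n]∣m y m)) (gcd[m,n]∣n y m)))

  solutionCount-translate : ∀ y {j} x₀ → x₀ * y % m ≡ j % m → solutionCount y j ≡ solutionCount y 0
  solutionCount-translate y {j} x₀ x₀-solves = begin
    ∑[ x < m ] 𝟙 (x * y % m ≟ j % m)          ≡⟨ ∑-rotate m _ (solution-periodic y j) x₀ ⟨
    ∑[ x < m ] 𝟙 ((x₀ + x) * y % m ≟ j % m)   ≡⟨ ∑-cong m (λ x _ →
                                                   𝟙-⇔ (shift x) ((x₀ + x) * y % m ≟ j % m) (x * y % m ≟ 0 % m)) ⟩
    ∑[ x < m ] 𝟙 (x * y % m ≟ 0 % m)          ∎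
    where
    j≡ : j % m ≡ (x₀ * y + 0) % m
    j≡ = trans (sym x₀-solves) (cong (_% m) (sym (+-identityʳ (x₀ * y))))
    shift : ∀ x → (x₀ + x) * y % m ≡ j % m ⇔ x * y % m ≡ 0 % m
    shift x = mk⇔ (λ eq → %-+-cancelˡ (x₀ * y) (trans (sym distrib) (trans eq j≡)))
                  (λ eq → trans distrib (trans (%-+-congˡ (x₀ * y) eq) (sym j≡)))
      where
      distrib : (x₀ + x) * y % m ≡ (x₀ * y + x * y) % m
      distrib = cong (_% m) (*-distribʳ-+ y x₀ x)

  gcd-residue : ∀ y → ∃[ x ] x * y % m ≡ gcd y m % m
  gcd-residue y with Bézout.identity (gcd-GCD y m)
  ... | Bézout.Identity.+- x z eq = x , (begin
    x * y % m              ≡⟨ cong (_% m) eq ⟨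
    (gcd y m + z * m) % m  ≡⟨ [m+kn]%n≡m%n (gcd y m) z m ⟩
    gcd y m % m            ∎)
  -- Here x y ≡ − gcd y m, so (m − 1) x y ≡ gcd y m.
  ... | Bézout.Identity.-+ x z eq = pred m * x , %-+-cancelˡ (x * y) (begin
    (x * y + pred m * x * y) % m    ≡⟨ cong (λ t → (x * y + t) % m) (*-assoc (pred m) x y) ⟩
    (x * y + pred m * (x * y)) % m  ≡⟨ cong (λ d → d * (x * y) % m) (suc-pred m) ⟩
    m * (x * y) % m                 ≡⟨ n∣m⇒m%n≡0 (m * (x * y)) m (m∣m*n (x * y)) ⟩
    0                               ≡⟨ m*n%n≡0 z m ⟨
    z * m % m                       ≡⟨ cong (_% m) eq ⟨
    (gcd y m + x * y) % m           ≡⟨ cong (_% m) (+-comm (gcd y m) (x * y)) ⟩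
    (x * y + gcd y m) % m           ∎)

  solutionCount-solvable : ∀ y {j} → gcd y m ∣ j → solutionCount y j ≡ solutionCount y 0
  solutionCount-solvable y (divides e refl) with gcd-residue y
  ... | x , x-solves = solutionCount-translate y (e * x) (begin
    e * x * y % m      ≡⟨ cong (_% m) (*-assoc e x y) ⟩
    e * (x * y) % m    ≡⟨ %-*-congˡ e x-solves ⟩
    e * gcd y m % m    ∎)

  solutionCount-gcd : ∀ y i → solutionCount y i ≡ solutionCount y (gcd i m)
  solutionCount-gcd y i with gcd y m ∣? i
  ... | yes g∣i = trans (solutionCount-solvable y g∣i)
                        (sym (solutionCount-solvable y (gcd-greatest g∣i (gcd[m,n]∣n y m))))
  ... | no  g∤i = trans (solutionCount-unsolvable g∤i)
                        (sym (solutionCount-unsolvable (λ g∣gcd → g∤i (∣-trans g∣gcd (gcd[m,n]∣m i m)))))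

corollary6p10 : (k m i : ℕ) → 1 < k → 1 < m → .{{_ : NonZero m}} → i < m →
    rM i m k ≡ rM (gcd i m) m k
corollary6p10 (suc (suc k)) m i _ _ _ = begin
  rM i m (2 + k)                                          ≡⟨ rM≡∑solutionCount m k i ⟩
  ∑[ a < m ^ k ] (m * solutionCount m (P m a k) i)         ≡⟨ ∑-cong (m ^ k) (λ a _ →
                                                               cong (m *_) (solutionCount-gcd m (P m a k) i)) ⟩
  ∑[ a < m ^ k ] (m * solutionCount m (P m a k) (gcd i m)) ≡⟨ rM≡∑solutionCount m k (gcd i m) ⟨
  rM (gcd i m) m (2 + k)                                  ∎
corollary6p10 (suc zero) _ _ (s≤s ()) _ _
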